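{- For every integer $j\geq 8$, $m_j(C_3,C_3,(j-4)K_2)=2$.
   Context: $K_{j\times t}$ denotes the complete multipartite graph with $j$ partite sets, each of size $t$. For graphs $H_1,\ldots,H_k$, the multipartite Ramsey number $m_j(H_1,\ldots,H_k)$ is the smallest positive integer $t$ such that for every $k$-edge-coloring $(G^1,\ldots,G^k)$ of $K_{j\times t}$ (partition of its edges into spanning subgraphs), some $G^\ell$ contains a copy of $H_\ell$; it is $\infty$ if no such $t$ exists. $C_3$ is the triangle and $nK_2$ is a matching of $n$ edges. -}

module Defs where

open import Level using (0ℓ)
open import Data.Nat using (ℕ; _≤_; _<_)
open import Data.Fin using (Fin)
open import Data.Product using (_×_; Σ; proj₁; proj₂; _,_; ∃)
open import Data.Vec using (Vec; lookup; _∷_; [])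
open import Relation.Binary.PropositionalEquality using (_≡_; _≢_)
open import Relation.Nullary using (¬_)
open import Function.Definitions using (Injective)

record Graph : Set₁ where
  field
    V   : Set
    Adj : V → V → Set
open Graph public

Contains : Graph → Graph → Set
Contains G H = Σ (V H → V G) λ f →
  Injective _≡_ _≡_ f × (∀ a b → Adj H a b → Adj G (f a) (f b))

C3 : Graph
C3 = record { V = Fin 3 ; Adj = λ a b → a ≢ b }

matching : ℕ → Graph
matching n = record
  { V = Fin n × Fin 2
  ; Adj = λ u v → (proj₁ u ≡ proj₁ v) × (proj₂ u ≢ proj₂ v) }

KMulti : ℕ → ℕ → Graph
KMulti j t = record
  { V = Fin j × Fin t
  ; Adj = λ u v → proj₁ u ≢ proj₁ v }

-- A k-edge-colouring of G: symmetric colour assignment on edges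
-- (values on non-edges are irrelevant).
record Colouring (k : ℕ) (G : Graph) : Set where
  field
    col : V G → V G → Fin k
    sym : ∀ u v → Adj G u v → col u v ≡ col v u
open Colouring public

ColourClass : ∀ {k} (G : Graph) → Colouring k G → Fin k → Graph
ColourClass G c ℓ = record
  { V = V G
  ; Adj = λ u v → Adj G u v × (col c u v ≡ ℓ) }

Arrows : ∀ {k} → ℕ → ℕ → Vec Graph k → Set
Arrows {k} j t Hs = (c : Colouring k (KMulti j t)) →
  ∃ λ (ℓ : Fin k) → Contains (ColourClass (KMulti j t) c ℓ) (lookup Hs ℓ)

MRamseyIs : ∀ {k} → ℕ → Vec Graph k → ℕ → Set
MRamseyIs j Hs t =
  (1 ≤ t) × Arrows j t Hs × (∀ s → 1 ≤ s → s < t → ¬ Arrows j s Hs)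

-- Let M be a maximal green matching of K_{j×2} (j = n + 4) and U the set of
-- unmatched vertices, so that U spans no green edge and 2|M| + |U| = 2j.  The vertices of U
-- lying on a fixed side of their parts are in pairwise distinct parts, so they span a red/blue
-- complete graph; if there are six of them, R(3,3) = 6 gives a red or blue triangle.  Otherwise
-- |U| ≤ 10, and either |M| ≥ n or |M| = n − 1, |U| = 10 and U is the union of five whole parts.
-- In the latter case take an edge xy of M.  If x had a non-green neighbour in each of these five
-- parts, those neighbours together with x would again span a red/blue K₆; so both x and y are
-- green to all of some part of U, and replacing xy by two green edges into U enlarges M to n edges.
--
-- On K_{n+4} with n ≥ 1, colour a 5-cycle red, its diagonals blue and every other
-- edge green.  There is no red or blue triangle, and every green edge meets one of the n − 1
-- vertices off the pentagon, so there is no green matching with n edges.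
module Submission where

open import Data.Empty using (⊥-elim)
open import Data.Fin using (Fin; zero; suc; inject≤; toℕ; splitAt; join)
open import Data.Fin.Properties as Finₚ using (_≟_; inject≤-injective; join-splitAt; injective⇒≤)
open import Data.List using (List; []; _∷_; _++_; length; lookup; map; allFin; cartesianProduct)
open import Data.List.Properties using (length-++; length-map; length-tabulate)
open import Data.List.Membership.Propositional using (_∈_; _∉_; find; lose)
open import Data.List.Membership.Propositional.Properties using (∈-∃++; ∈-lookup; ∈-++⁺ʳ)
import Data.List.Membership.DecPropositional as DecMembership
open import Data.List.Relation.Unary.All as All using (All; []; _∷_; all?)
open import Data.List.Relation.Unary.All.Properties as Allₚ using (All¬⇒¬Any; ¬Any⇒All¬; ¬All⇒Any¬)
open import Data.List.Relation.Unary.AllPairs as AllPairs using (AllPairs; []; _∷_)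
import Data.List.Relation.Unary.AllPairs.Properties as AllPairsₚ
open import Data.List.Relation.Unary.Any using (here; there; any?)
open import Data.List.Relation.Unary.Unique.Propositional using (Unique)
open import Data.List.Relation.Unary.Unique.Propositional.Properties
  using (cartesianProduct⁺; allFin⁺; Unique[x∷xs]⇒x∉xs)
open import Data.List.Relation.Binary.Sublist.Propositional using (_⊆_; []; _∷_; _∷ʳ_; minimum; ⊆-refl)
import Data.List.Relation.Binary.Sublist.Propositional.Properties as Sublist
open import Data.List.Relation.Binary.Permutation.Propositional
  using (_↭_; prep; swap; ↭-refl; ↭-sym; ↭-trans; ↭⇒↭ₛ)
open import Data.List.Relation.Binary.Permutation.Propositional.Properties
  using (shift; shifts; ++⁺ˡ; ∈-resp-↭; ↭-length)
import Data.List.Relation.Binary.Permutation.Setoid.Properties as Permutationₛ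
open import Data.Nat using (ℕ; zero; suc; _+_; _*_; _∸_; _≤_; _<_; z≤n; s≤s; s≤s⁻¹; _≤?_; ∣_-_∣)
open import Data.Nat.Properties
  using ( +-suc; +-comm; *-suc; *-distribˡ-+; +-cancelˡ-≤; +-cancelʳ-≤; +-cancelˡ-≡; *-cancelˡ-≤
        ; +-monoʳ-≤; +-monoˡ-≤; +-mono-≤; ≤-trans; ≤-reflexive; ≤-antisym; ≰⇒>; n≮n
        ; ∣-∣-comm; ∸-monoˡ-≤; m+[n∸m]≡n; module ≤-Reasoning)
open import Data.Product using (_×_; _,_; Σ; ∃; ∃-syntax; uncurry; proj₁; proj₂)
open import Data.Product.Properties using (≡-dec)
open import Data.Sum as Sum using (_⊎_; inj₁; inj₂)
open import Data.Vec as Vec using (Vec; _∷_; [])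
open import Function using (_∘_)
open import Relation.Binary.PropositionalEquality
  using (_≡_; _≢_; refl; sym; trans; cong; cong₂; subst; subst₂; setoid)
open import Relation.Nullary using (¬_; Dec; yes; no)
open import Relation.Nullary.Decidable using (¬?; _×-dec_; _→-dec_; from-yes)
open import Relation.Unary using (Decidable)

open import Defs hiding (sym)

module _ {A : Set} where

  AllPairs-resp-⊆ : ∀ {R : A → A → Set} {xs ys} → xs ⊆ ys → AllPairs R ys → AllPairs R xs
  AllPairs-resp-⊆ []           []         = []
  AllPairs-resp-⊆ (_ ∷ʳ xs⊆)   (_ ∷ Rys)  = AllPairs-resp-⊆ xs⊆ Rys
  AllPairs-resp-⊆ (refl ∷ xs⊆) (Ry ∷ Rys) = Sublist.All-resp-⊆ xs⊆ Ry ∷ AllPairs-resp-⊆ xs⊆ Rys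

  AllPairs-tabulate : ∀ {R : A → A → Set} {xs} → (∀ {x y} → x ∈ xs → y ∈ xs → R x y) → AllPairs R xs
  AllPairs-tabulate {xs = []}     _  = []
  AllPairs-tabulate {xs = x ∷ xs} R∈ =
    All.tabulate (R∈ (here refl) ∘ there) ∷ AllPairs-tabulate (λ x∈ y∈ → R∈ (there x∈) (there y∈))

  Unique-resp-↭ : ∀ {xs ys : List A} → xs ↭ ys → Unique xs → Unique ys
  Unique-resp-↭ xs↭ys = Permutationₛ.Unique-resp-↭ (setoid A) (↭⇒↭ₛ xs↭ys)

  Unique-++ˡ : ∀ {xs : List A} ys → Unique (xs ++ ys) → Unique xs
  Unique-++ˡ ys = AllPairs-resp-⊆ (Sublist.++⁺ʳ ys ⊆-refl)

  Unique-++ʳ : ∀ xs {ys : List A} → Unique (xs ++ ys) → Unique ys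
  Unique-++ʳ xs = AllPairs-resp-⊆ (Sublist.++⁺ˡ xs ⊆-refl)

  select : ∀ {x xs} → x ∈ xs → ∃ λ (ys : List A) → xs ↭ x ∷ ys
  select x∈ with ys , zs , refl ← ∈-∃++ x∈ = ys ++ zs , shift _ ys zs

  select₂ : ∀ {x y xs} → x ∈ xs → y ∈ xs → x ≢ y → ∃ λ (zs : List A) → xs ↭ x ∷ y ∷ zs
  select₂ x∈ y∈ x≢y with ys , xs↭ ← select x∈ with ∈-resp-↭ xs↭ y∈
  ... | here y≡x   = ⊥-elim (x≢y (sym y≡x))
  ... | there y∈ys with zs , ys↭ ← select y∈ys = zs , ↭-trans xs↭ (prep _ ys↭)

  Selection : (A → Set) → ℕ → List A → Set
  Selection P k ys = ∃[ zs ] zs ⊆ ys × length zs ≡ k × All P zs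

  pigeonhole : ∀ {P Q : A → Set} m n {ys} → All (λ y → P y ⊎ Q y) ys → m + n < length ys →
               Selection P (suc m) ys ⊎ Selection Q (suc n) ys
  pigeonhole zero    n {y ∷ ys} (inj₁ py ∷ _) _ = inj₁ (y ∷ [] , refl ∷ minimum ys , refl , py ∷ [])
  pigeonhole (suc m) n {y ∷ ys} (inj₁ py ∷ pqs) (s≤s m+n<) with pigeonhole m n pqs m+n<
  ... | inj₁ (zs , zs⊆ , len , pzs) = inj₁ (y ∷ zs , refl ∷ zs⊆ , cong suc len , py ∷ pzs)
  ... | inj₂ (zs , zs⊆ , len , qzs) = inj₂ (zs , y ∷ʳ zs⊆ , len , qzs)
  pigeonhole m zero    {y ∷ ys} (inj₂ qy ∷ _) _ = inj₂ (y ∷ [] , refl ∷ minimum ys , refl , qy ∷ [])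
  pigeonhole m (suc n) {y ∷ ys} (inj₂ qy ∷ pqs) (s≤s m+n<)
    with pigeonhole m n pqs (subst (_≤ length ys) (+-suc m n) m+n<)
  ... | inj₁ (zs , zs⊆ , len , pzs) = inj₁ (zs , y ∷ʳ zs⊆ , len , pzs)
  ... | inj₂ (zs , zs⊆ , len , qzs) = inj₂ (y ∷ zs , refl ∷ zs⊆ , cong suc len , qy ∷ qzs)

  Triangle : (A → A → Set) → Set
  Triangle R = ∃[ a ] ∃[ b ] ∃[ c ] R a b × R a c × R b c

  private
    fan : ∀ {R B : A → A → Set} {x y₁ y₂ y₃} → AllPairs (λ a b → R a b ⊎ B a b) (y₁ ∷ y₂ ∷ y₃ ∷ []) →
          R x y₁ → R x y₂ → R x y₃ → Triangle R ⊎ Triangle B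
    fan ((c₁₂ ∷ c₁₃ ∷ []) ∷ (c₂₃ ∷ []) ∷ [] ∷ []) r₁ r₂ r₃ with c₁₂ | c₁₃ | c₂₃
    ... | inj₁ r₁₂ | _        | _        = inj₁ (_ , _ , _ , r₁ , r₂ , r₁₂)
    ... | _        | inj₁ r₁₃ | _        = inj₁ (_ , _ , _ , r₁ , r₃ , r₁₃)
    ... | _        | _        | inj₁ r₂₃ = inj₁ (_ , _ , _ , r₂ , r₃ , r₂₃)
    ... | inj₂ b₁₂ | inj₂ b₁₃ | inj₂ b₂₃ = inj₂ (_ , _ , _ , b₁₂ , b₁₃ , b₂₃)

  ramsey-3-3 : ∀ {R B : A → A → Set} {xs} → AllPairs (λ a b → R a b ⊎ B a b) xs → 6 ≤ length xs →
               Triangle R ⊎ Triangle B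
  ramsey-3-3 (cs ∷ pairs) (s≤s 5≤) with pigeonhole 2 2 cs 5≤
  ... | inj₁ (_ ∷ _ ∷ _ ∷ [] , ys⊆ , _ , r₁ ∷ r₂ ∷ r₃ ∷ []) =
    fan (AllPairs-resp-⊆ ys⊆ pairs) r₁ r₂ r₃
  ... | inj₂ (_ ∷ _ ∷ _ ∷ [] , ys⊆ , _ , b₁ ∷ b₂ ∷ b₃ ∷ []) =
    Sum.swap (fan (AllPairs.map Sum.swap (AllPairs-resp-⊆ ys⊆ pairs)) b₁ b₂ b₃)

-- Matchings given by lists of edges

module _ {A : Set} where

  endpoints : List (A × A) → List A
  endpoints []             = []
  endpoints ((x , y) ∷ es) = x ∷ y ∷ endpoints es

  length-endpoints : ∀ es → length (endpoints es) ≡ 2 * length es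
  length-endpoints []             = refl
  length-endpoints ((x , y) ∷ es) = trans (cong (2 +_) (length-endpoints es)) (sym (*-suc 2 (length es)))

  endpoint : Fin 2 → A × A → A
  endpoint zero       = proj₁
  endpoint (suc zero) = proj₂

  endpoint-∈ : ∀ es i b → endpoint b (lookup es i) ∈ endpoints es
  endpoint-∈ ((x , y) ∷ es) zero    zero       = here refl
  endpoint-∈ ((x , y) ∷ es) zero    (suc zero) = there (here refl)
  endpoint-∈ ((x , y) ∷ es) (suc i) b          = there (there (endpoint-∈ es i b))

  endpoint-∉ : ∀ {x y es} → Unique (x ∷ y ∷ endpoints es) → ∀ b → endpoint b (x , y) ∉ endpoints es
  endpoint-∉ ((_ ∷ x∉) ∷ _) zero       = All¬⇒¬Any x∉
  endpoint-∉ (_ ∷ y∉ ∷ _)   (suc zero) = All¬⇒¬Any y∉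

  endpoint-injective : ∀ es → Unique (endpoints es) → ∀ {i j b c} →
                       endpoint b (lookup es i) ≡ endpoint c (lookup es j) → (i , b) ≡ (j , c)
  endpoint-injective (_ ∷ _) _ {zero} {zero} {zero}     {zero}     _ = refl
  endpoint-injective (_ ∷ _) _ {zero} {zero} {suc zero} {suc zero} _ = refl
  endpoint-injective (_ ∷ _) ((x≢y ∷ _) ∷ _) {zero} {zero} {zero}     {suc zero} x≡y = ⊥-elim (x≢y x≡y)
  endpoint-injective (_ ∷ _) ((x≢y ∷ _) ∷ _) {zero} {zero} {suc zero} {zero}     y≡x = ⊥-elim (x≢y (sym y≡x))
  endpoint-injective (_ ∷ es) uniq {zero} {suc j} {b} {c} e =
    ⊥-elim (endpoint-∉ uniq b (subst (_∈ endpoints es) (sym e) (endpoint-∈ es j c)))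
  endpoint-injective (_ ∷ es) uniq {suc i} {zero} {b} {c} e =
    ⊥-elim (endpoint-∉ uniq c (subst (_∈ endpoints es) e (endpoint-∈ es i b)))
  endpoint-injective (_ ∷ es) (_ ∷ _ ∷ uniq) {suc i} {suc j} {b} {c} e
    with endpoint-injective es uniq {i} {j} {b} {c} e
  ... | refl = refl

  record Matching (G : A → A → Set) (vs : List A) : Set where
    field
      edges     : List (A × A)
      unmatched : List A
      adjacent  : All (uncurry G) edges
      partition : vs ↭ endpoints edges ++ unmatched

  Matching-length : ∀ {G vs} (m : Matching G vs) →
                    length vs ≡ 2 * length (Matching.edges m) + length (Matching.unmatched m)
  Matching-length record { edges = es ; unmatched = U ; partition = vs↭ } =
    trans (↭-length vs↭) (trans (length-++ (endpoints es)) (cong (_+ length U) (length-endpoints es)))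

  Independent : (A → A → Set) → List A → Set
  Independent G U = ∀ {u v} → u ∈ U → v ∈ U → ¬ G u v

  MaximalMatching : (A → A → Set) → List A → Set
  MaximalMatching G vs = Σ (Matching G vs) (Independent G ∘ Matching.unmatched)

  module _ {G : A → A → Set} (G? : ∀ x → Decidable (G x))
           (G-sym : ∀ {x y} → G x y → G y x) (G-irrefl : ∀ {x} → ¬ G x x) where

    maximalMatching : ∀ vs → MaximalMatching G vs
    maximalMatching [] = record { edges = [] ; unmatched = [] ; adjacent = [] ; partition = ↭-refl } , λ ()
    maximalMatching (v ∷ vs) with maximalMatching vs
    ... | record { edges = E ; unmatched = U ; adjacent = adj ; partition = vs↭ } , indep
      with any? (G? v) U
    ... | yes v~U with u , u∈U , vu ← find v~U with rest , U↭ ← select u∈U =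
      record { edges = (v , u) ∷ E ; unmatched = rest ; adjacent = vu ∷ adj
             ; partition = prep v (↭-trans vs↭ (↭-trans (++⁺ˡ (endpoints E) U↭) (shift u (endpoints E) rest)))
             } ,
      λ w∈ w′∈ → indep (in-U w∈) (in-U w′∈)
      where
      in-U : ∀ {w} → w ∈ rest → w ∈ U
      in-U w∈ = ∈-resp-↭ (↭-sym U↭) (there w∈)
    ... | no v≁U =
      record { edges = E ; unmatched = v ∷ U ; adjacent = adj
             ; partition = ↭-trans (prep v vs↭) (↭-sym (shift v (endpoints E) U)) } ,
      λ { (here refl) (here refl)  → G-irrefl
        ; (here refl) (there w∈) vw → v≁U (lose w∈ vw)
        ; (there w∈)  (here refl) wv → v≁U (lose w∈ (G-sym wv))
        ; (there w∈)  (there w′∈)   → indep w∈ w′∈ }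

  augment : ∀ {G vs x y u u′ es U U′} → All (uncurry G) es → vs ↭ x ∷ y ∷ endpoints es ++ U →
            U ↭ u ∷ u′ ∷ U′ → G x u → G y u′ → Matching G vs
  augment {x = x} {y} {u} {u′} {es} {U′ = U′} adj vs↭ U↭ xu yu′ = record
    { edges     = (x , u) ∷ (y , u′) ∷ es
    ; unmatched = U′
    ; adjacent  = xu ∷ yu′ ∷ adj
    ; partition = ↭-trans vs↭ (prep x (↭-trans (prep y (↭-trans (++⁺ˡ (endpoints es) U↭)
                    (shifts (endpoints es) (u ∷ u′ ∷ [])))) (swap y u ↭-refl)))
    }

module _ (Γ : Graph) (Adj-sym : ∀ {a b} → Adj Γ a b → Adj Γ b a) where

  triangle⇒C3 : (∀ {a} → ¬ Adj Γ a a) → ∀ {a b c} → Adj Γ a b → Adj Γ a c → Adj Γ b c → Contains Γ C3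
  triangle⇒C3 Adj-irrefl {a} {b} {c} ab ac bc = f , injective , adjacent
    where
    f : Fin 3 → V Γ
    f zero             = a
    f (suc zero)       = b
    f (suc (suc zero)) = c

    adjacent : ∀ i k → i ≢ k → Adj Γ (f i) (f k)
    adjacent zero             (suc zero)       _   = ab
    adjacent zero             (suc (suc zero)) _   = ac
    adjacent (suc zero)       (suc (suc zero)) _   = bc
    adjacent (suc zero)       zero             _   = Adj-sym ab
    adjacent (suc (suc zero)) zero             _   = Adj-sym ac
    adjacent (suc (suc zero)) (suc zero)       _   = Adj-sym bc
    adjacent zero             zero             i≢i = ⊥-elim (i≢i refl)
    adjacent (suc zero)       (suc zero)       i≢i = ⊥-elim (i≢i refl)
    adjacent (suc (suc zero)) (suc (suc zero)) i≢i = ⊥-elim (i≢i refl)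

    injective : ∀ {i k} → f i ≡ f k → i ≡ k
    injective {i} {k} fi≡fk with i ≟ k
    ... | yes i≡k = i≡k
    ... | no  i≢k = ⊥-elim (Adj-irrefl (subst (Adj Γ (f i)) (sym fi≡fk) (adjacent i k i≢k)))

  matching-mono : ∀ {m n} → m ≤ n → Contains Γ (matching n) → Contains Γ (matching m)
  matching-mono m≤n (f , f-injective , f-adjacent) = f ∘ widen , injective , adjacent
    where
    widen : V (matching _) → V (matching _)
    widen (i , b) = inject≤ i m≤n , b

    injective : ∀ {u v} → f (widen u) ≡ f (widen v) → u ≡ v
    injective {i , _} {j , _} e =
      cong₂ _,_ (inject≤-injective m≤n m≤n i j (cong proj₁ (f-injective e))) (cong proj₂ (f-injective e))

    adjacent : ∀ u v → Adj (matching _) u v → Adj Γ (f (widen u)) (f (widen v))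
    adjacent u v (refl , b≢c) = f-adjacent (widen u) (widen v) (refl , b≢c)

  Matching⇒Contains : ∀ {vs} → Unique vs → (m : Matching (Adj Γ) vs) →
                      Contains Γ (matching (length (Matching.edges m)))
  Matching⇒Contains uniq record { edges = es ; unmatched = U ; adjacent = adj ; partition = vs↭ } =
    f , endpoint-injective es (Unique-++ˡ U (Unique-resp-↭ vs↭ uniq)) , adjacent
    where
    f : Fin (length es) × Fin 2 → V Γ
    f (i , b) = endpoint b (lookup es i)

    adjacent : ∀ u v → Adj (matching (length es)) u v → Adj Γ (f u) (f v)
    adjacent (i , zero)     (_ , suc zero) (refl , _)   = All.lookup adj (∈-lookup i)
    adjacent (i , suc zero) (_ , zero)     (refl , _)   = Adj-sym (All.lookup adj (∈-lookup i))
    adjacent (_ , zero)     (_ , zero)     (_ , b≢b)    = ⊥-elim (b≢b refl)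
    adjacent (_ , suc zero) (_ , suc zero) (_ , b≢b)    = ⊥-elim (b≢b refl)

ColourClass-sym : ∀ {k j t} (c : Colouring k (KMulti j t)) ℓ {u v} →
                  Adj (ColourClass (KMulti j t) c ℓ) u v → Adj (ColourClass (KMulti j t) c ℓ) v u
ColourClass-sym c ℓ {u} {v} (u≁v , uv≡ℓ) = u≁v ∘ sym , trans (sym (Colouring.sym c u v u≁v)) uv≡ℓ

ColourClass-irrefl : ∀ {k j t} (c : Colouring k (KMulti j t)) ℓ {u} → ¬ Adj (ColourClass (KMulti j t) c ℓ) u u
ColourClass-irrefl c ℓ (u≁u , _) = u≁u refl

-- Upper bound

private
  2*[5+a]≡2*a+10 : ∀ a → 2 * (5 + a) ≡ 2 * a + 10
  2*[5+a]≡2*a+10 a = trans (*-distribˡ-+ 2 5 a) (+-comm 10 (2 * a))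

  count⇒n≤1+a : ∀ {a u n} → 2 * a + u ≡ 2 * (4 + n) → u ≤ 10 → n ≤ suc a
  count⇒n≤1+a {a} {u} {n} count u≤10 = +-cancelˡ-≤ 4 _ _ (*-cancelˡ-≤ 2 (begin
    2 * (4 + n)  ≡⟨ sym count ⟩
    2 * a + u    ≤⟨ +-monoʳ-≤ (2 * a) u≤10 ⟩
    2 * a + 10   ≡⟨ 2*[5+a]≡2*a+10 a ⟨
    2 * (5 + a)  ∎))
    where open ≤-Reasoning

  count⇒u≡10 : ∀ {a u} → 2 * a + u ≡ 2 * (4 + suc a) → u ≡ 10
  count⇒u≡10 {a} count = +-cancelˡ-≡ (2 * a) _ _ (trans count (2*[5+a]≡2*a+10 a))

  halves-of-10 : ∀ {a b} → a + b ≡ 10 → a ≤ 5 → b ≤ 5 → 5 ≤ a × 5 ≤ b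
  halves-of-10 {a} {b} a+b≡10 a≤5 b≤5 =
    +-cancelʳ-≤ 5 5 a (≤-trans 10≤a+b (+-monoʳ-≤ a b≤5)) ,
    +-cancelˡ-≤ 5 5 b (≤-trans 10≤a+b (+-monoˡ-≤ b a≤5))
    where
    10≤a+b : 10 ≤ a + b
    10≤a+b = ≤-reflexive (sym a+b≡10)

red blue green : Fin 3
red   = zero
blue  = suc zero
green = suc (suc zero)

vertices : ∀ j → List (Fin j × Fin 2)
vertices j = cartesianProduct (allFin j) (allFin 2)

length-vertices : ∀ j → length (vertices j) ≡ 2 * j
length-vertices j = trans (length-pairs (allFin j)) (cong (2 *_) (length-tabulate {n = j} (λ i → i)))
  where
  length-pairs : (qs : List (Fin j)) → length (cartesianProduct qs (allFin 2)) ≡ 2 * length qs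
  length-pairs []       = refl
  length-pairs (q ∷ qs) = trans (cong (2 +_) (length-pairs qs)) (sym (*-suc 2 (length qs)))

module UpperBound (n : ℕ) (c : Colouring 3 (KMulti (4 + n) 2)) where

  Vertex : Set
  Vertex = Fin (4 + n) × Fin 2

  open DecMembership {A = Vertex} (≡-dec _≟_ _≟_) using (_∈?_)

  Class : Fin 3 → Graph
  Class = ColourClass (KMulti (4 + n) 2) c

  Green : Vertex → Vertex → Set
  Green = Adj (Class green)

  green? : ∀ u v → Dec (Green u v)
  green? u v = ¬? (proj₁ u ≟ proj₁ v) ×-dec (col c u v ≟ green)

  NonGreen : Vertex → Vertex → Set
  NonGreen u v = proj₁ u ≢ proj₁ v × ¬ Green u v

  RedOrBlueTriangle : Set
  RedOrBlueTriangle = Contains (Class red) C3 ⊎ Contains (Class blue) C3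

  GreenMatching : ℕ → Set
  GreenMatching = Contains (Class green) ∘ matching

  _>>=_ : ∀ {A B : Set} → RedOrBlueTriangle ⊎ A → (A → RedOrBlueTriangle ⊎ B) → RedOrBlueTriangle ⊎ B
  inj₁ t >>= _ = inj₁ t
  inj₂ a >>= k = k a

  nonGreen⇒redOrBlue : ∀ {u v} → NonGreen u v → Adj (Class red) u v ⊎ Adj (Class blue) u v
  nonGreen⇒redOrBlue {u} {v} (u≁v , u≁ᵍv) = classify (col c u v) refl
    where
    classify : ∀ ℓ → col c u v ≡ ℓ → Adj (Class red) u v ⊎ Adj (Class blue) u v
    classify zero             uv = inj₁ (u≁v , uv)
    classify (suc zero)       uv = inj₂ (u≁v , uv)
    classify (suc (suc zero)) uv = ⊥-elim (u≁ᵍv (u≁v , uv))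

  nonGreen⇒triangle : ∀ {W} → AllPairs NonGreen W → 6 ≤ length W → RedOrBlueTriangle
  nonGreen⇒triangle pairs 6≤ with ramsey-3-3 (AllPairs.map nonGreen⇒redOrBlue pairs) 6≤
  ... | inj₁ (_ , _ , _ , ab , ac , bc) =
    inj₁ (triangle⇒C3 (Class red) (ColourClass-sym c red) (ColourClass-irrefl c red) ab ac bc)
  ... | inj₂ (_ , _ , _ , ab , ac , bc) =
    inj₂ (triangle⇒C3 (Class blue) (ColourClass-sym c blue) (ColourClass-irrefl c blue) ab ac bc)

  transversal-nonGreen : ∀ {U} → Independent Green U → (Q : List (Fin (4 + n))) (f : Fin (4 + n) → Fin 2) →
                         Unique Q → (∀ {q} → q ∈ Q → (q , f q) ∈ U) →
                         AllPairs NonGreen (map (λ q → q , f q) Q)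
  transversal-nonGreen indep Q f uniq f∈ =
    AllPairsₚ.map⁺ (AllPairs.zip (uniq , AllPairs-tabulate λ q∈ r∈ → indep (f∈ q∈) (f∈ r∈)))

  side : Fin 2 → List Vertex → List (Fin (4 + n))
  side b []             = []
  side b ((q , b′) ∷ U) with b′ ≟ b
  ... | yes _ = q ∷ side b U
  ... | no  _ = side b U

  side-∈ : ∀ {b q} U → q ∈ side b U → (q , b) ∈ U
  side-∈ {b} ((q′ , b′) ∷ U) q∈ with b′ ≟ b | q∈
  ... | yes refl | here refl = here refl
  ... | yes refl | there q∈U = there (side-∈ U q∈U)
  ... | no  _    | q∈U       = there (side-∈ U q∈U)

  side-unique : ∀ b {U} → Unique U → Unique (side b U)
  side-unique b {[]}           []           = []
  side-unique b {(q , b′) ∷ U} (v∉U ∷ uniq) with b′ ≟ b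
  ... | yes refl = ¬Any⇒All¬ (side b U) (All¬⇒¬Any v∉U ∘ side-∈ U) ∷ side-unique b uniq
  ... | no  _    = side-unique b uniq

  length-sides : ∀ U → length (side zero U) + length (side (suc zero) U) ≡ length U
  length-sides []                   = refl
  length-sides ((q , zero) ∷ U)     = cong suc (length-sides U)
  length-sides ((q , suc zero) ∷ U) = trans (+-suc _ _) (cong suc (length-sides U))

  module _ {U : List Vertex} (U-unique : Unique U) (U-indep : Independent Green U) where

    side-nonGreen : ∀ b → AllPairs NonGreen (map (_, b) (side b U))
    side-nonGreen b = transversal-nonGreen U-indep (side b U) (λ _ → b) (side-unique b U-unique) (side-∈ U)

    side≤5 : ∀ b → RedOrBlueTriangle ⊎ length (side b U) ≤ 5
    side≤5 b with length (side b U) ≤? 5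
    ... | yes ≤5 = inj₂ ≤5
    ... | no  ≰5 =
      inj₁ (nonGreen⇒triangle (side-nonGreen b) (subst (6 ≤_) (sym (length-map _ (side b U))) (≰⇒> ≰5)))

    Full : Set
    Full = All (λ q → (q , suc zero) ∈ U) (side zero U)

    full? : 5 ≤ length (side (suc zero) U) → RedOrBlueTriangle ⊎ Full
    full? 5≤U₁ with all? (λ q → (q , suc zero) ∈? U) (side zero U)
    ... | yes full = inj₂ full
    ... | no ¬full with q , q∈U₀ , q₁∉U ← find (¬All⇒Any¬ (λ q → (q , suc zero) ∈? U) _ ¬full) =
      inj₁ (nonGreen⇒triangle (Allₚ.map⁺ (All.tabulate apart) ∷ side-nonGreen (suc zero))
                              (s≤s (subst (5 ≤_) (sym (length-map _ (side (suc zero) U))) 5≤U₁)))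
      where
      apart : ∀ {r} → r ∈ side (suc zero) U → NonGreen (q , zero) (r , suc zero)
      apart r∈ = (λ { refl → q₁∉U (side-∈ U r∈) }) , U-indep (side-∈ U q∈U₀) (side-∈ U r∈)

    GreenPart : Vertex → Set
    GreenPart x = ∃[ q ] q ∈ side zero U × Green x (q , zero) × Green x (q , suc zero)

    module _ (full : Full) where

      part⊆U : ∀ {q} → q ∈ side zero U → ∀ b → (q , b) ∈ U
      part⊆U q∈ zero       = side-∈ U q∈
      part⊆U q∈ (suc zero) = All.lookup full q∈

      green-part : 5 ≤ length (side zero U) → ∀ x → x ∉ U → RedOrBlueTriangle ⊎ GreenPart x
      green-part 5≤U₀ x x∉U with any? (λ q → green? x (q , zero) ×-dec green? x (q , suc zero)) (side zero U)
      ... | yes found with q , q∈ , g₀ , g₁ ← find found = inj₂ (q , q∈ , g₀ , g₁)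
      ... | no none =
        inj₁ (nonGreen⇒triangle
               (Allₚ.map⁺ (All.tabulate apart) ∷
                transversal-nonGreen U-indep (side zero U) pick (side-unique zero U-unique)
                                     (λ q∈ → part⊆U q∈ _))
               (s≤s (subst (5 ≤_) (sym (length-map _ (side zero U))) 5≤U₀)))
        where
        choose : ∀ {P : Set} → Dec P → Fin 2
        choose (yes _) = suc zero
        choose (no  _) = zero

        pick : Fin (4 + n) → Fin 2
        pick q = choose (green? x (q , zero))

        pick-nonGreen : ∀ {q} → q ∈ side zero U → ¬ Green x (q , choose (green? x (q , zero)))
        pick-nonGreen {q} q∈ with green? x (q , zero)
        ... | yes g₀ = λ g₁ → none (lose q∈ (g₀ , g₁))
        ... | no ¬g₀ = ¬g₀

        apart : ∀ {q} → q ∈ side zero U → NonGreen x (q , pick q)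
        apart q∈ = (λ { refl → x∉U (part⊆U q∈ (proj₂ x)) }) , pick-nonGreen q∈

      distinct-green-neighbours : ∀ {x y} → GreenPart x → GreenPart y →
                                ∃[ u ] ∃[ u′ ] u ∈ U × u′ ∈ U × u ≢ u′ × Green x u × Green y u′
      distinct-green-neighbours (qx , qx∈ , gx₀ , _) (qy , qy∈ , gy₀ , gy₁) with qx ≟ qy
      ... | yes refl =
        (qx , zero) , (qx , suc zero) , part⊆U qx∈ zero , part⊆U qx∈ (suc zero) , (λ ()) , gx₀ , gy₁
      ... | no  qx≢qy =
        (qx , zero) , (qy , zero) , part⊆U qx∈ zero , part⊆U qy∈ zero , qx≢qy ∘ cong proj₁ , gx₀ , gy₀

  vertices-unique : Unique (vertices (4 + n))
  vertices-unique = cartesianProduct⁺ (allFin⁺ (4 + n)) (allFin⁺ 2)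

  augment-or-triangle : ∀ {E U} → vertices (4 + n) ↭ endpoints E ++ U → All (uncurry Green) E →
                        Independent Green U →
                      1 ≤ length E → 5 ≤ length (side zero U) × 5 ≤ length (side (suc zero) U) →
                      RedOrBlueTriangle ⊎ GreenMatching (suc (length E))
  augment-or-triangle {(x , y) ∷ es} {U} vs↭ (_ ∷ adj) U-indep _ (5≤U₀ , 5≤U₁) = do
    full ← full? U-unique U-indep 5≤U₁
    gx   ← green-part U-unique U-indep full 5≤U₀ x x∉U
    gy   ← green-part U-unique U-indep full 5≤U₀ y y∉U
    let u , u′ , u∈ , u′∈ , u≢u′ , xu , yu′ = distinct-green-neighbours U-unique U-indep full gx gy
        U′ , U↭ = select₂ u∈ u′∈ u≢u′
    inj₂ (Matching⇒Contains (Class green) (ColourClass-sym c green) vertices-unique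
                            (augment adj vs↭ U↭ xu yu′))
    where
    xyEU-unique : Unique (x ∷ y ∷ endpoints es ++ U)
    xyEU-unique = Unique-resp-↭ vs↭ vertices-unique

    U-unique : Unique U
    U-unique = Unique-++ʳ (x ∷ y ∷ endpoints es) xyEU-unique

    x∉U : x ∉ U
    x∉U = Unique[x∷xs]⇒x∉xs xyEU-unique ∘ ∈-++⁺ʳ (y ∷ endpoints es)

    y∉U : y ∉ U
    y∉U = Unique[x∷xs]⇒x∉xs (AllPairs.tail xyEU-unique) ∘ ∈-++⁺ʳ (endpoints es)

  from-maximal-matching : 2 ≤ n → MaximalMatching Green (vertices (4 + n)) → RedOrBlueTriangle ⊎ GreenMatching n
  from-maximal-matching 2≤n
    (m@record { edges = E ; unmatched = U ; adjacent = adj ; partition = vs↭ } , U-indep) = do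
    U₀≤5 ← side≤5 U-unique U-indep zero
    U₁≤5 ← side≤5 U-unique U-indep (suc zero)
    enough-or-one-short U₀≤5 U₁≤5
    where
    U-unique : Unique U
    U-unique = Unique-++ʳ (endpoints E) (Unique-resp-↭ vs↭ vertices-unique)

    count : 2 * length E + length U ≡ 2 * (4 + n)
    count = trans (sym (Matching-length m)) (length-vertices (4 + n))

    one-short : length (side zero U) ≤ 5 → length (side (suc zero) U) ≤ 5 → n ≡ suc (length E) →
               RedOrBlueTriangle ⊎ GreenMatching n
    one-short U₀≤5 U₁≤5 n≡1+a =
      subst (λ k → RedOrBlueTriangle ⊎ GreenMatching k) (sym n≡1+a)
            (augment-or-triangle {E} {U} vs↭ adj U-indep (s≤s⁻¹ (subst (2 ≤_) n≡1+a 2≤n)) balanced)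
      where
      U≡10 : length (side zero U) + length (side (suc zero) U) ≡ 10
      U≡10 = trans (length-sides U)
                   (count⇒u≡10 (subst (λ k → 2 * length E + length U ≡ 2 * (4 + k)) n≡1+a count))

      balanced : 5 ≤ length (side zero U) × 5 ≤ length (side (suc zero) U)
      balanced = halves-of-10 U≡10 U₀≤5 U₁≤5

    enough-or-one-short : length (side zero U) ≤ 5 → length (side (suc zero) U) ≤ 5 →
                       RedOrBlueTriangle ⊎ GreenMatching n
    enough-or-one-short U₀≤5 U₁≤5 with n ≤? length E
    ... | yes n≤a = inj₂ (matching-mono (Class green) (ColourClass-sym c green) n≤a
                            (Matching⇒Contains (Class green) (ColourClass-sym c green) vertices-unique m))
    ... | no  n≰a = one-short U₀≤5 U₁≤5 (≤-antisym (count⇒n≤1+a count U≤10) (≰⇒> n≰a))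
      where
      U≤10 : length U ≤ 10
      U≤10 = subst (_≤ 10) (length-sides U) (+-mono-≤ U₀≤5 U₁≤5)

  triangle-or-green-matching : 2 ≤ n → RedOrBlueTriangle ⊎ GreenMatching n
  triangle-or-green-matching 2≤n =
    from-maximal-matching 2≤n
      (maximalMatching green? (ColourClass-sym c green) (ColourClass-irrefl c green) (vertices (4 + n)))

upper-bound : ∀ n → 2 ≤ n → Arrows (4 + n) 2 (C3 ∷ C3 ∷ matching n ∷ [])
upper-bound n 2≤n c = arrow (UpperBound.triangle-or-green-matching n c 2≤n)
  where
  open UpperBound n c using (Class; RedOrBlueTriangle; GreenMatching)

  arrow : RedOrBlueTriangle ⊎ GreenMatching n →
          ∃ λ ℓ → Contains (Class ℓ) (Vec.lookup (C3 ∷ C3 ∷ matching n ∷ []) ℓ)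
  arrow (inj₁ (inj₁ red-triangle))  = red , red-triangle
  arrow (inj₁ (inj₂ blue-triangle)) = blue , blue-triangle
  arrow (inj₂ green-matching)        = green , green-matching

-- Lower bound

-- The pentagon colours the 5-cycle red and the pentagram blue; pentagon a a = green is a junk
-- value, never used on an edge.
colourOfDistance : ℕ → Fin 3
colourOfDistance 1 = red
colourOfDistance 2 = blue
colourOfDistance 3 = blue
colourOfDistance 4 = red
colourOfDistance _ = green

pentagon : Fin 5 → Fin 5 → Fin 3
pentagon a b = colourOfDistance ∣ toℕ a - toℕ b ∣

pentagon-green⇒≡ : ∀ a b → pentagon a b ≡ green → a ≡ b
pentagon-green⇒≡ = from-yes (Finₚ.all? λ a → Finₚ.all? λ b → (pentagon a b ≟ green) →-dec (a ≟ b))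

pentagon-monochromatic⇒green : ∀ a b c → pentagon a b ≡ pentagon a c → pentagon a b ≡ pentagon b c →
                               pentagon a b ≡ green
pentagon-monochromatic⇒green = from-yes (Finₚ.all? λ a → Finₚ.all? λ b → Finₚ.all? λ c →
  (pentagon a b ≟ pentagon a c) →-dec ((pentagon a b ≟ pentagon b c) →-dec (pentagon a b ≟ green)))

module LowerBound (m : ℕ) where

  Block : Set
  Block = Fin 5 ⊎ Fin m

  blockColour : Block → Block → Fin 3
  blockColour (inj₁ a) (inj₁ b) = pentagon a b
  blockColour _        _        = green

  blockColour-sym : ∀ x y → blockColour x y ≡ blockColour y x
  blockColour-sym (inj₁ a) (inj₁ b) = cong colourOfDistance (∣-∣-comm (toℕ a) (toℕ b))
  blockColour-sym (inj₁ _) (inj₂ _) = refl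
  blockColour-sym (inj₂ _) (inj₁ _) = refl
  blockColour-sym (inj₂ _) (inj₂ _) = refl

  blockColour-monochromatic⇒green : ∀ x y z → blockColour x y ≡ blockColour x z →
                                    blockColour x y ≡ blockColour y z → blockColour x y ≡ green
  blockColour-monochromatic⇒green (inj₁ a) (inj₁ b) (inj₁ c) = pentagon-monochromatic⇒green a b c
  blockColour-monochromatic⇒green (inj₁ _) (inj₁ _) (inj₂ _) xy≡xz _ = xy≡xz
  blockColour-monochromatic⇒green (inj₁ _) (inj₂ _) _        _     _ = refl
  blockColour-monochromatic⇒green (inj₂ _) _        _        _     _ = refl

  block : Fin (5 + m) × Fin 1 → Block
  block (p , _) = splitAt 5 p

  block-injective : ∀ {u v} → block u ≡ block v → u ≡ v
  block-injective {p , zero} {q , zero} e =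
    cong (_, zero) (trans (sym (join-splitAt 5 m p)) (trans (cong (join 5 m) e) (join-splitAt 5 m q)))

  colouring : Colouring 3 (KMulti (5 + m) 1)
  colouring = record
    { col = λ u v → blockColour (block u) (block v)
    ; sym = λ u v _ → blockColour-sym (block u) (block v)
    }

  Class : Fin 3 → Graph
  Class = ColourClass (KMulti (5 + m) 1) colouring

  no-triangle : ∀ ℓ → ℓ ≢ green → ¬ Contains (Class ℓ) C3
  no-triangle ℓ ℓ≢green (f , _ , adj) =
    ℓ≢green (trans (sym ab) (blockColour-monochromatic⇒green (block (f a)) (block (f b)) (block (f c))
                                                              (trans ab (sym ac)) (trans ab (sym bc))))
    where
    a b c : Fin 3
    a = zero
    b = suc zero
    c = suc (suc zero)

    ab : blockColour (block (f a)) (block (f b)) ≡ ℓ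
    ab = proj₂ (adj a b (λ ()))

    ac : blockColour (block (f a)) (block (f c)) ≡ ℓ
    ac = proj₂ (adj a c (λ ()))

    bc : blockColour (block (f b)) (block (f c)) ≡ ℓ
    bc = proj₂ (adj b c (λ ()))

  no-green-matching : ¬ Contains (Class green) (matching (suc m))
  no-green-matching (f , f-injective , adj) = n≮n m (injective⇒≤ outer-injective)
    where
    outer-end : ∀ i → ∃[ b ] ∃[ t ] block (f (i , b)) ≡ inj₂ t
    outer-end i with block (f (i , zero)) in e₀ | block (f (i , suc zero)) in e₁
    ... | inj₂ t | _      = zero , t , e₀
    ... | inj₁ _ | inj₂ t = suc zero , t , e₁
    ... | inj₁ a | inj₁ b = ⊥-elim (proj₁ edge (cong proj₁ (block-injective {f (i , zero)} {f (i , suc zero)}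
                                 (trans e₀ (trans (cong inj₁ a≡b) (sym e₁))))))
      where
      edge : Adj (Class green) (f (i , zero)) (f (i , suc zero))
      edge = adj (i , zero) (i , suc zero) (refl , λ ())

      a≡b : a ≡ b
      a≡b = pentagon-green⇒≡ a b (subst₂ (λ x y → blockColour x y ≡ green) e₀ e₁ (proj₂ edge))

    outer : Fin (suc m) → Fin m
    outer i = proj₁ (proj₂ (outer-end i))

    outer-injective : ∀ {i j} → outer i ≡ outer j → i ≡ j
    outer-injective {i} {j} e with outer-end i | outer-end j
    ... | _ , _ , fi | _ , _ , fj =
      cong proj₁ (f-injective (block-injective (trans fi (trans (cong inj₂ e) (sym fj)))))

lower-bound : ∀ n → 1 ≤ n → ¬ Arrows (4 + n) 1 (C3 ∷ C3 ∷ matching n ∷ [])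
lower-bound (suc m) _ arrows with arrows (LowerBound.colouring m)
... | zero           , triangle       = LowerBound.no-triangle m red (λ ()) triangle
... | suc zero       , triangle       = LowerBound.no-triangle m blue (λ ()) triangle
... | suc (suc zero) , green-matching = LowerBound.no-green-matching m green-matching

lemma5 : ∀ (j : ℕ) → 8 ≤ j → MRamseyIs j (C3 ∷ C3 ∷ matching (j ∸ 4) ∷ []) 2
lemma5 j 8≤j = s≤s z≤n , subst (λ k → Arrows k 2 Hs) 4+n≡j (upper-bound n 2≤n) , smaller
  where
  n : ℕ
  n = j ∸ 4

  Hs : Vec Graph 3
  Hs = C3 ∷ C3 ∷ matching n ∷ []

  2≤n : 2 ≤ n
  2≤n = ≤-trans (s≤s (s≤s z≤n)) (∸-monoˡ-≤ 4 8≤j)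

  4+n≡j : 4 + n ≡ j
  4+n≡j = m+[n∸m]≡n (≤-trans (s≤s (s≤s (s≤s (s≤s z≤n)))) 8≤j)

  smaller : ∀ s → 1 ≤ s → s < 2 → ¬ Arrows j s Hs
  smaller (suc zero)    _ _ = subst (λ k → ¬ Arrows k 1 Hs) 4+n≡j (lower-bound n (≤-trans (s≤s z≤n) 2≤n))
  smaller (suc (suc _)) _ (s≤s (s≤s ()))
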